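{- For every integer $n\geq 5$, the open triangular ladder $O(TL_n)$ satisfies $\chi_g(O(TL_n))=7$.
   Context: All graphs are finite, simple and connected. A graceful $k$-coloring of a non-empty graph $G$ ($k\geq 2$) is a proper vertex coloring $f:V(G)\to\{1,2,\dots,k\}$ such that the induced edge coloring $f^*(uv)=|f(u)-f(v)|$, with values in $\{1,\dots,k-1\}$, is a proper edge coloring. The graceful chromatic number $\chi_g(G)$ is the minimum such $k$. The triangular ladder $TL_n$ has vertex set $\{x_i,y_i:1\leq i\leq n\}$ and edge set $\{x_ix_{i+1},\,y_iy_{i+1},\,x_iy_{i+1}:1\leq i\leq n-1\}\cup\{x_iy_i:1\leq i\leq n\}$. The open triangular ladder $O(TL_n)$ is obtained from $TL_n$ by removing the edges $x_1y_1$ and $x_ny_n$. -}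

module Defs where

open import Level using (0ℓ)
open import Data.Nat using (ℕ; suc; _≤_; _<_; _∸_; _⊔_)
open import Data.Nat.Properties using ()
open import Data.Fin using (Fin; toℕ)
open import Data.Sum using (_⊎_; inj₁; inj₂)
open import Data.Product using (_×_; Σ; ∃)
open import Relation.Binary.PropositionalEquality using (_≡_; _≢_)
open import Relation.Nullary using (¬_)

record Graph : Set₁ where
  field
    V    : Set
    Adj  : V → V → Set
    sym  : ∀ {u v} → Adj u v → Adj v u
    irr  : ∀ {v} → ¬ Adj v v
open Graph public

dist : ℕ → ℕ → ℕ
dist a b = (a ∸ b) ⊔ (b ∸ a)

record GracefulColoring (G : Graph) (k : ℕ) : Set where
  field
    f        : V G → ℕ
    range    : ∀ v → 1 ≤ f v × f v ≤ k
    proper   : ∀ {u v} → Adj G u v → f u ≢ f v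
    edgeProp : ∀ {u v w} → Adj G u v → Adj G u w → v ≢ w →
               dist (f u) (f v) ≢ dist (f u) (f w)

GracefulChromaticNumberIs : Graph → ℕ → Set
GracefulChromaticNumberIs G k =
  2 ≤ k × GracefulColoring G k × (∀ j → j < k → ¬ GracefulColoring G j)

-- Open triangular ladder O(TL_n): vertices x_i = inj₁ i, y_i = inj₂ i,
-- i ∈ Fin n (index i here is the paper's i+1).
data OTLEdge (n : ℕ) : Fin n ⊎ Fin n → Fin n ⊎ Fin n → Set where
  xx   : ∀ {i j : Fin n} → suc (toℕ i) ≡ toℕ j → OTLEdge n (inj₁ i) (inj₁ j)
  yy   : ∀ {i j : Fin n} → suc (toℕ i) ≡ toℕ j → OTLEdge n (inj₂ i) (inj₂ j)
  xy⁺  : ∀ {i j : Fin n} → suc (toℕ i) ≡ toℕ j → OTLEdge n (inj₁ i) (inj₂ j)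
  rung : ∀ {i : Fin n} → 0 < toℕ i → suc (toℕ i) < n → OTLEdge n (inj₁ i) (inj₂ i)

OTLAdj : (n : ℕ) → Fin n ⊎ Fin n → Fin n ⊎ Fin n → Set
OTLAdj n u v = OTLEdge n u v ⊎ OTLEdge n v u

private
  otl-sym : ∀ {n} {u v} → OTLAdj n u v → OTLAdj n v u
  otl-sym (inj₁ e) = inj₂ e
  otl-sym (inj₂ e) = inj₁ e

  suc≢ : ∀ (m : ℕ) → ¬ (suc m ≡ m)
  suc≢ ℕ.zero ()
  suc≢ (suc m) p = suc≢ m (Data.Nat.Properties.suc-injective p)

  noloop : ∀ {n} {v} → ¬ OTLEdge n v v
  noloop (xx {i} p) = suc≢ (toℕ i) p
  noloop (yy {i} p) = suc≢ (toℕ i) p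

  otl-irr : ∀ {n} {v} → ¬ OTLAdj n v v
  otl-irr (inj₁ e) = noloop e
  otl-irr (inj₂ e) = noloop e

OpenTriangularLadder : ℕ → Graph
OpenTriangularLadder n = record
  { V = Fin n ⊎ Fin n ; Adj = OTLAdj n ; sym = otl-sym ; irr = otl-irr }

-- Upper bound: color x_i and y_i by (1,3,6) and (5,7,2) according to i mod 3.  Around every
-- vertex the five "slots" (the vertex itself, the path neighbors ahead and behind, the diagonal
-- neighbor and the rung neighbor) then carry five different labels, so labels at a vertex are
-- distinct and no edge gets label 0.
-- Lower bound: O(TL_5) is a subgraph of O(TL_n), and an exhaustive backtracking search, pruned
-- only by conditions every graceful coloring satisfies, finds no graceful 6-coloring of it.
module Submission where

open import Defs hiding (sym)
open import Data.Bool.Base using (Bool; true; T; _∧_)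
open import Data.Bool.ListAction using (any)
open import Data.Bool.Properties using (T-∧)
open import Data.Empty using (⊥-elim)
open import Data.Fin.Base using (Fin; toℕ; zero; suc; inject≤)
import Data.Fin.Properties as Fin
open import Data.List.Base using (List; []; _∷_; map; applyUpTo; concatMap; allFin)
open import Data.List.Membership.Propositional using (_∈_)
open import Data.List.Membership.Propositional.Properties using (∈-applyUpTo⁺)
open import Data.List.Relation.Unary.All using (All; all?; universal)
open import Data.List.Relation.Unary.All.Properties using (map⁺)
import Data.List.Relation.Unary.Any as Any
open import Data.List.Relation.Unary.Any.Properties using (any⁺)
open import Data.Nat.Base using (ℕ; pred; _+_; _≤_; s≤s; z≤n; s≤s⁻¹)
import Data.Nat.Base as ℕ
open import Data.Nat.Properties using (_≟_; _≤?_; _<?_; ≤-trans; 1+n≢n)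
open import Data.Product.Base using (_×_; _,_; proj₁; proj₂; uncurry)
open import Data.Sum.Base using (_⊎_; inj₁; inj₂)
import Data.Sum.Base as Sum
open import Data.Sum.Properties using (inj₁-injective; inj₂-injective; ≡-dec)
open import Data.Vec.Base using (Vec; []; _∷_; lookup)
open import Function.Base using (_∘_)
open import Function.Bundles using (Equivalence)
open import Function.Definitions using (Injective)
open import Relation.Binary.Definitions using (Decidable; DecidableEquality)
open import Relation.Binary.PropositionalEquality using (_≡_; _≢_; refl; sym; trans; cong; subst)
open import Relation.Nullary.Decidable
  using (Dec; yes; no; isYes; map′; from-yes; fromWitness; _×-dec_; _⊎-dec_; _→-dec_; ¬?)
open import Relation.Nullary.Negation using (¬_)

⊎-map-injective : ∀ {A B C D : Set} {f : A → C} {g : B → D} →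
                  Injective _≡_ _≡_ f → Injective _≡_ _≡_ g →
                  Injective _≡_ _≡_ (Sum.map f g)
⊎-map-injective f-inj g-inj {inj₁ _} {inj₁ _} eq = cong inj₁ (f-inj (inj₁-injective eq))
⊎-map-injective f-inj g-inj {inj₂ _} {inj₂ _} eq = cong inj₂ (g-inj (inj₂-injective eq))
⊎-map-injective f-inj g-inj {inj₁ _} {inj₂ _} ()
⊎-map-injective f-inj g-inj {inj₂ _} {inj₁ _} ()

module _ {G : Graph} where

  weaken : ∀ {j k} → j ≤ k → GracefulColoring G j → GracefulColoring G k
  weaken j≤k C = record
    { f        = f
    ; range    = λ v → proj₁ (range v) , ≤-trans (proj₂ (range v)) j≤k
    ; proper   = proper
    ; edgeProp = edgeProp
    }
    where open GracefulColoring C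

  gracefulChromaticNumber-intro : ∀ {k} → 2 ≤ ℕ.suc k → GracefulColoring G (ℕ.suc k) →
                                  ¬ GracefulColoring G k → GracefulChromaticNumberIs G (ℕ.suc k)
  gracefulChromaticNumber-intro 2≤k+1 C ¬C = 2≤k+1 , C , λ j j<k+1 D → ¬C (weaken (s≤s⁻¹ j<k+1) D)

record LocallyInjectiveHom (H G : Graph) : Set where
  field
    to                : V H → V G
    adj-preserved     : ∀ {u v} → Adj H u v → Adj G (to u) (to v)
    locally-injective : ∀ {u v w} → Adj H u v → Adj H u w → to v ≡ to w → v ≡ w

pullback : ∀ {H G k} → LocallyInjectiveHom H G → GracefulColoring G k → GracefulColoring H k
pullback φ C = record
  { f        = f ∘ to
  ; range    = range ∘ to
  ; proper   = proper ∘ adj-preserved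
  ; edgeProp = λ uv uw v≢w → edgeProp (adj-preserved uv) (adj-preserved uw)
                                       (v≢w ∘ locally-injective uv uw)
  }
  where open GracefulColoring C
        open LocallyInjectiveHom φ

-- Completeness of a backtracking search: it only prunes a partial coloring when it violates
-- a condition of a graceful coloring, so if the search fails there is no graceful coloring.
module Backtracking (G : Graph) (adj? : Decidable (Adj G)) (_≟ᵥ_ : DecidableEquality (V G)) where

  Colored : Set
  Colored = V G × ℕ

  ProperPair : Colored → Colored → Set
  ProperPair (u , a) (v , b) = Adj G u v → a ≢ b

  GracefulTriple : Colored → Colored → Colored → Set
  GracefulTriple (u , a) (v , b) (w , c) = Adj G u v → Adj G u w → v ≢ w → dist a b ≢ dist a c

  Fits : Colored → List Colored → Set
  Fits p ρ =
    All (λ q → ProperPair p q × All (λ r → GracefulTriple p q r × GracefulTriple q p r) ρ) ρ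

  fits? : ∀ p ρ → Dec (Fits p ρ)
  fits? p ρ = all? (λ q → properPair? p q ×-dec
                          all? (λ r → gracefulTriple? p q r ×-dec gracefulTriple? q p r) ρ) ρ
    where
    properPair? : ∀ p q → Dec (ProperPair p q)
    properPair? (u , a) (v , b) = adj? u v →-dec ¬? (a ≟ b)

    gracefulTriple? : ∀ p q r → Dec (GracefulTriple p q r)
    gracefulTriple? (u , a) (v , b) (w , c) =
      adj? u v →-dec adj? u w →-dec ¬? (v ≟ᵥ w) →-dec ¬? (dist a b ≟ dist a c)

  colors : ℕ → List ℕ
  colors k = applyUpTo ℕ.suc k

  ∈-colors : ∀ {c k} → 1 ≤ c → c ≤ k → c ∈ colors k
  ∈-colors (s≤s _) c≤k = ∈-applyUpTo⁺ ℕ.suc c≤k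

  extendable : ℕ → List (V G) → List Colored → Bool
  extendable k []       ρ = true
  extendable k (v ∷ vs) ρ =
    any (λ c → isYes (fits? (v , c) ρ) ∧ extendable k vs ((v , c) ∷ ρ)) (colors k)

  module _ {k} (C : GracefulColoring G k) where
    open GracefulColoring C

    coloredBy : List (V G) → List Colored
    coloredBy = map (λ w → w , f w)

    fits-coloredBy : ∀ v ws → Fits (v , f v) (coloredBy ws)
    fits-coloredBy v ws =
      map⁺ (universal (λ _ → proper , map⁺ (universal (λ _ → edgeProp , edgeProp) ws)) ws)

    extendable-complete : ∀ vs ws → T (extendable k vs (coloredBy ws))
    extendable-complete []       ws = _
    extendable-complete (v ∷ vs) ws = any⁺ _ (Any.map fv-extends (uncurry ∈-colors (range v)))
      where
      ρ = coloredBy ws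
      fv-extends : ∀ {c} → f v ≡ c →
                   T (isYes (fits? (v , c) ρ) ∧ extendable k vs ((v , c) ∷ ρ))
      fv-extends refl =
        Equivalence.from T-∧ (fromWitness (fits-coloredBy v ws) , extendable-complete vs (v ∷ ws))

otlEdge? : ∀ n → Decidable (OTLEdge n)
otlEdge? n (inj₁ i) (inj₁ j) = map′ xx (λ { (xx p) → p }) (ℕ.suc (toℕ i) ≟ toℕ j)
otlEdge? n (inj₂ i) (inj₂ j) = map′ yy (λ { (yy p) → p }) (ℕ.suc (toℕ i) ≟ toℕ j)
otlEdge? n (inj₂ i) (inj₁ j) = no λ ()
otlEdge? n (inj₁ i) (inj₂ j) with i Fin.≟ j
... | yes refl = map′ (uncurry rung) (λ { (rung p q) → p , q ; (xy⁺ p) → ⊥-elim (1+n≢n p) })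
                      (0 <? toℕ i ×-dec ℕ.suc (toℕ i) <? n)
... | no i≢j   = map′ xy⁺ (λ { (xy⁺ p) → p ; (rung _ _) → ⊥-elim (i≢j refl) })
                      (ℕ.suc (toℕ i) ≟ toℕ j)

otlAdj? : ∀ n → Decidable (OTLAdj n)
otlAdj? n u v = otlEdge? n u v ⊎-dec otlEdge? n v u

ladderInclusion : ∀ {m n} → m ≤ n →
                  LocallyInjectiveHom (OpenTriangularLadder m) (OpenTriangularLadder n)
ladderInclusion {m} {n} m≤n = record
  { to                = ι
  ; adj-preserved     = Sum.map edge edge
  ; locally-injective = λ _ _ → ⊎-map-injective (Fin.inject≤-injective m≤n m≤n _ _)
                                                (Fin.inject≤-injective m≤n m≤n _ _)
  }
  where
  ι : Fin m ⊎ Fin m → Fin n ⊎ Fin n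
  ι = Sum.map (λ i → inject≤ i m≤n) (λ i → inject≤ i m≤n)

  successor : ∀ {i j : Fin m} → ℕ.suc (toℕ i) ≡ toℕ j →
              ℕ.suc (toℕ (inject≤ i m≤n)) ≡ toℕ (inject≤ j m≤n)
  successor {i} {j} p rewrite Fin.toℕ-inject≤ i m≤n | Fin.toℕ-inject≤ j m≤n = p

  edge : ∀ {u v} → OTLEdge m u v → OTLEdge n (ι u) (ι v)
  edge (xx p)                  = xx (successor p)
  edge (yy p)                  = yy (successor p)
  edge (xy⁺ p)                 = xy⁺ (successor p)
  edge (rung {i} 0<i i+1<m) rewrite sym (Fin.toℕ-inject≤ i m≤n) = rung 0<i (≤-trans i+1<m m≤n)

-- The vertices rung by rung, x₀, y₀, x₁, y₁, …: in this order the search below stays small.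
ladderVertices : ∀ n → List (Fin n ⊎ Fin n)
ladderVertices n = concatMap (λ i → inj₁ i ∷ inj₂ i ∷ []) (allFin n)

noGracefulColoring-O[TL₅] : ¬ GracefulColoring (OpenTriangularLadder 5) 6
noGracefulColoring-O[TL₅] C = extendable-complete C (ladderVertices 5) []
  where open Backtracking (OpenTriangularLadder 5) (otlAdj? 5) (≡-dec Fin._≟_ Fin._≟_)

X Y : ℕ → ℕ
X 0 = 1
X 1 = 3
X 2 = 6
X (ℕ.suc (ℕ.suc (ℕ.suc m))) = X m
Y 0 = 5
Y 1 = 7
Y 2 = 2
Y (ℕ.suc (ℕ.suc (ℕ.suc m))) = Y m

paint : ℕ ⊎ ℕ → ℕ
paint (inj₁ m) = X m
paint (inj₂ m) = Y m

Slot : Set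
Slot = Fin 5

pattern self     = zero
pattern ahead    = suc zero
pattern behind   = suc (suc zero)
pattern diagonal = suc (suc (suc zero))
pattern across   = suc (suc (suc (suc zero)))

step : ℕ ⊎ ℕ → Slot → ℕ ⊎ ℕ
step p        self     = p
step (inj₁ m) ahead    = inj₁ (ℕ.suc m)
step (inj₁ m) behind   = inj₁ (pred m)
step (inj₁ m) diagonal = inj₂ (ℕ.suc m)
step (inj₁ m) across   = inj₂ m
step (inj₂ m) ahead    = inj₂ (ℕ.suc m)
step (inj₂ m) behind   = inj₂ (pred m)
step (inj₂ m) diagonal = inj₁ (pred m)
step (inj₂ m) across   = inj₁ m

-- The labels seen from a position, slot by slot.  Index m - 1 is written m + 2, which has the
-- same color whenever it exists; this keeps the labels 3-periodic in m.
labels : ℕ ⊎ ℕ → Vec ℕ 5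
labels (inj₁ m) = dist (X m) (X m) ∷ dist (X m) (X (1 + m)) ∷ dist (X m) (X (2 + m))
                ∷ dist (X m) (Y (1 + m)) ∷ dist (X m) (Y m) ∷ []
labels (inj₂ m) = dist (Y m) (Y m) ∷ dist (Y m) (Y (1 + m)) ∷ dist (Y m) (Y (2 + m))
                ∷ dist (Y m) (X (2 + m)) ∷ dist (Y m) (X m) ∷ []

label : ℕ ⊎ ℕ → Slot → ℕ
label p = lookup (labels p)

label-self : ∀ p → label p self ≡ dist (paint p) (paint p)
label-self (inj₁ _) = refl
label-self (inj₂ _) = refl

WellLabelled : ℕ ⊎ ℕ → Set
WellLabelled p = (1 ≤ paint p × paint p ≤ 7) × (∀ k l → label p k ≡ label p l → k ≡ l)

wellLabelled? : ∀ p → Dec (WellLabelled p)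
wellLabelled? p = (1 ≤? paint p ×-dec paint p ≤? 7)
           ×-dec Fin.all? (λ k → Fin.all? λ l → label p k ≟ label p l →-dec k Fin.≟ l)

wellLabelled : ∀ p → WellLabelled p
wellLabelled (inj₁ 0) = from-yes (wellLabelled? (inj₁ 0))
wellLabelled (inj₁ 1) = from-yes (wellLabelled? (inj₁ 1))
wellLabelled (inj₁ 2) = from-yes (wellLabelled? (inj₁ 2))
wellLabelled (inj₁ (ℕ.suc (ℕ.suc (ℕ.suc m)))) = wellLabelled (inj₁ m)
wellLabelled (inj₂ 0) = from-yes (wellLabelled? (inj₂ 0))
wellLabelled (inj₂ 1) = from-yes (wellLabelled? (inj₂ 1))
wellLabelled (inj₂ 2) = from-yes (wellLabelled? (inj₂ 2))
wellLabelled (inj₂ (ℕ.suc (ℕ.suc (ℕ.suc m)))) = wellLabelled (inj₂ m)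

record Placed (p q : ℕ ⊎ ℕ) : Set where
  constructor placed
  field
    slot     : Slot
    at       : q ≡ step p slot
    labelled : dist (paint p) (paint q) ≡ label p slot

placed-self : ∀ p → Placed p p
placed-self p = placed self refl (sym (label-self p))

placed-unique : ∀ {p q r} → Placed p q → Placed p r →
                dist (paint p) (paint q) ≡ dist (paint p) (paint r) → q ≡ r
placed-unique {p} (placed k at lab) (placed l at′ lab′) eq =
  trans at (trans (cong (step p) k≡l) (sym at′))
  where k≡l = proj₂ (wellLabelled p) k l (trans (sym lab) (trans eq lab′))

module _ {n : ℕ} where

  position : Fin n ⊎ Fin n → ℕ ⊎ ℕ
  position = Sum.map toℕ toℕ

  placement : ∀ {u v} → OTLAdj n u v → Placed (position u) (position v)
  placement (inj₁ (xx p))     = subst (λ m → Placed _ (inj₁ m)) p (placed ahead refl refl)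
  placement (inj₁ (yy p))     = subst (λ m → Placed _ (inj₂ m)) p (placed ahead refl refl)
  placement (inj₁ (xy⁺ p))    = subst (λ m → Placed _ (inj₂ m)) p (placed diagonal refl refl)
  placement (inj₁ (rung _ _)) = placed across refl refl
  placement (inj₂ (xx p))     = subst (λ m → Placed (inj₁ m) _) p (placed behind refl refl)
  placement (inj₂ (yy p))     = subst (λ m → Placed (inj₂ m) _) p (placed behind refl refl)
  placement (inj₂ (xy⁺ p))    = subst (λ m → Placed (inj₂ m) _) p (placed diagonal refl refl)
  placement (inj₂ (rung _ _)) = placed across refl refl

periodicColoring : ∀ n → GracefulColoring (OpenTriangularLadder n) 7
periodicColoring n = record
  { f        = color
  ; range    = λ u → proj₁ (wellLabelled (position u))
  ; proper   = λ {u} uv cu≡cv →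
      let v≡u = same-label uv (placed-self (position u)) (cong (dist (color u)) (sym cu≡cv))
      in  irr (OpenTriangularLadder n) (subst (OTLAdj n u) v≡u uv)
  ; edgeProp = λ uv uw v≢w eq → v≢w (same-label uv (placement uw) eq)
  }
  where
  color : Fin n ⊎ Fin n → ℕ
  color = paint ∘ position

  same-label : ∀ {u v w} → OTLAdj n u v → Placed (position u) (position w) →
               dist (color u) (color v) ≡ dist (color u) (color w) → v ≡ w
  same-label uv w-placed eq =
    ⊎-map-injective Fin.toℕ-injective Fin.toℕ-injective (placed-unique (placement uv) w-placed eq)

corollary3p6 : (n : ℕ) → 5 ≤ n → GracefulChromaticNumberIs (OpenTriangularLadder n) 7
corollary3p6 n 5≤n =
  gracefulChromaticNumber-intro (s≤s (s≤s z≤n)) (periodicColoring n)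
    (noGracefulColoring-O[TL₅] ∘ pullback (ladderInclusion 5≤n))
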